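{- Let $r\geq 1$ and $a\geq 2$ be integers. Define $\mathcal{D}=(d_1,d_2,\ldots,d_{3r+2})$ by $d_1=1$, $d_2=2$, $d_k=d_{k-1}+a$ if $k$ is odd and $3\leq k<2r+2$, $d_k=d_{k-1}+1$ if $k$ is even and $3<k\leq 2r+2$, and $d_k=d_{k-1}+a+1$ if $2r+2<k\leq 3r+2$. Then $\mathcal{D}$ has pattern $(+++-\cdots-+)$, i.e., its prefix coin systems of lengths $1,2,3$ are orderly, its prefix coin systems of lengths $4,\ldots,3r+1$ are not orderly, and $\mathcal{D}$ itself is orderly.
   Context: A coin system is a tuple $(c_1,\ldots,c_n)$ of integers with $c_1=1<c_2<\cdots<c_n$; each coin value may be used any number of times. For a positive integer $v$, $opt(v)$ is the minimum number of coins summing to $v$, and $grd(v)$ is the number of coins used by the greedy algorithm (repeatedly take as many coins as possible of the largest coin value not exceeding the remaining amount). A coin system is orderly if $grd(v)=opt(v)$ for all $v>0$. The prefix coin system of length $i$ is $(c_1,\ldots,c_i)$; the pattern of a coin system is the string whose $i$-th symbol is $+$ if the prefix of length $i$ is orderly and $-$ otherwise. -}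

module Defs where

open import Data.Nat using (ℕ; zero; suc; _+_; _*_; _≤_; _<_; _≤ᵇ_; _/_; _%_)
open import Data.Bool using (Bool; true; false; if_then_else_)
open import Data.Nat.ListAction using (sum)
open import Data.List using (List; []; _∷_; length; reverse; applyUpTo)
open import Data.List.Relation.Unary.All using (All)
open import Data.List.Membership.Propositional using (_∈_)
open import Data.Product using (Σ; _×_)
open import Relation.Binary.PropositionalEquality using (_≡_)

-- A coin system is given as the list (c₁, …, cₙ) in increasing order.

Rep : List ℕ → ℕ → List ℕ → Set
Rep cs v xs = All (_∈ cs) xs × sum xs ≡ v

IsOpt : List ℕ → ℕ → ℕ → Set
IsOpt cs v k =
  Σ (List ℕ) (λ xs → Rep cs v xs × length xs ≡ k)
  × (∀ xs → Rep cs v xs → k ≤ length xs)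

grdDesc : List ℕ → ℕ → ℕ
grdDesc [] v = 0
grdDesc (zero ∷ cs) v = grdDesc cs v
grdDesc (suc c ∷ cs) v = v / suc c + grdDesc cs (v % suc c)

grd : List ℕ → ℕ → ℕ
grd cs v = grdDesc (reverse cs) v

Orderly : List ℕ → Set
Orderly cs = ∀ v → 0 < v → IsOpt cs v (grd cs v)

isOdd : ℕ → Bool
isOdd zero = false
isOdd (suc n) = if isOdd n then false else true

-- The sequence d_k (k ≥ 1) for parameters r, a (d 0 is a dummy value).
d : ℕ → ℕ → ℕ → ℕ
d r a zero = 0
d r a (suc zero) = 1
d r a (suc (suc zero)) = 2
d r a (suc (suc (suc j))) =
  let k = suc (suc (suc j)) in
  d r a (suc (suc j)) +
    (if k ≤ᵇ 2 * r + 2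
       then (if isOdd k then a else 1)
       else a + 1)

prefix : ℕ → ℕ → ℕ → List ℕ
prefix r a i = applyUpTo (λ j → d r a (suc j)) i

-- Greedy is optimal for a coin system containing 1 as soon as adding a coin c to any
-- amount w raises the greedy count by at most one, and since grd (P + w) = 1 + grd w for
-- the largest coin P it suffices to check this for w < P.  With b = a + 1 the coins of D
-- are 1 + k b (k ≤ r) and 2 + k b (k ≤ 2r); below the top coin M = 2 + 2r b an amount
-- 2 + j b + u with u < b costs 1 + ⌈u/2⌉ greedy coins, except that 2 + j b + a is itself
-- a coin when j < r, and the check becomes a case analysis on this description.  For
-- 4 ≤ i ≤ 3r + 1 two coins of the prefix add up to d_i + t with t = 3 or t = b, which
-- greedy pays with 1 + ⌈t/2⌉ ≥ 3 coins.

module Submission where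

open import Defs
open import Data.Nat
open import Data.Nat.Properties
open import Data.Nat.DivMod
open import Data.Nat.Induction using (<-rec)
open import Data.Nat.ListAction using (sum)
open import Data.Nat.ListAction.Properties using (sum-++)
open import Data.Nat.Tactic.RingSolver using (solve)
open import Data.Bool using (true; false; if_then_else_)
open import Data.Unit using (tt)
open import Data.Empty using (⊥-elim)
open import Data.List using (List; []; _∷_; length; reverse; replicate; _++_; applyUpTo; [_])
open import Data.List.Properties using (length-++; length-replicate; applyUpTo-∷ʳ; reverse-++)
open import Data.List.Relation.Unary.All as All using (All)
open import Data.List.Relation.Unary.All.Properties using (++⁺; replicate⁺)
open import Data.List.Relation.Unary.Any using (here; there)
open import Data.List.Relation.Unary.Any.Properties using (reverse⁺; reverse⁻)
open import Data.List.Membership.Propositional using (_∈_)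
open import Data.List.Membership.Propositional.Properties using (∈-applyUpTo⁺; ∈-applyUpTo⁻)
open import Data.Product using (∃; _×_; _,_; proj₂)
open import Data.Sum using (_⊎_; inj₁; inj₂)
open import Algebra.Properties.CommutativeSemigroup +-commutativeSemigroup using (x∙yz≈y∙xz)
open import Relation.Nullary using (¬_; yes; no)
open import Relation.Binary.PropositionalEquality hiding ([_])

-- Greedy change-making

grdDesc-zero : ∀ cs → grdDesc cs 0 ≡ 0
grdDesc-zero [] = refl
grdDesc-zero (zero ∷ cs) = grdDesc-zero cs
grdDesc-zero (suc c ∷ cs) = grdDesc-zero cs

grdDesc-skip : ∀ {c} cs {v} → v < c → grdDesc (c ∷ cs) v ≡ grdDesc cs v
grdDesc-skip {suc c} cs v<c = cong₂ _+_ (m<n⇒m/n≡0 v<c) (cong (grdDesc cs) (m<n⇒m%n≡m v<c))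

grdDesc-top : ∀ {c} cs w → 0 < c → grdDesc (c ∷ cs) (c + w) ≡ suc (grdDesc (c ∷ cs) w)
grdDesc-top {suc c} cs w _ = cong₂ _+_ quotient remainder
  where
  quotient : (suc c + w) / suc c ≡ suc (w / suc c)
  quotient = trans (m/n≡1+[m∸n]/n (m≤m+n (suc c) w)) (cong (λ x → suc (x / suc c)) (m+n∸m≡n (suc c) w))
  remainder : grdDesc cs ((suc c + w) % suc c) ≡ grdDesc cs (w % suc c)
  remainder = cong (grdDesc cs) (trans (cong (_% suc c) (+-comm (suc c) w)) ([m+n]%n≡m%n w (suc c)))

greedyCoins : List ℕ → ℕ → List ℕ
greedyCoins [] v = []
greedyCoins (zero ∷ cs) v = greedyCoins cs v
greedyCoins (suc c ∷ cs) v = replicate (v / suc c) (suc c) ++ greedyCoins cs (v % suc c)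

length-greedyCoins : ∀ cs v → length (greedyCoins cs v) ≡ grdDesc cs v
length-greedyCoins [] v = refl
length-greedyCoins (zero ∷ cs) v = length-greedyCoins cs v
length-greedyCoins (suc c ∷ cs) v = trans (length-++ (replicate (v / suc c) (suc c)))
  (cong₂ _+_ (length-replicate (v / suc c)) (length-greedyCoins cs (v % suc c)))

greedyCoins-⊆ : ∀ cs v → All (_∈ cs) (greedyCoins cs v)
greedyCoins-⊆ [] v = All.[]
greedyCoins-⊆ (zero ∷ cs) v = All.map there (greedyCoins-⊆ cs v)
greedyCoins-⊆ (suc c ∷ cs) v =
  ++⁺ (replicate⁺ (v / suc c) (here refl)) (All.map there (greedyCoins-⊆ cs (v % suc c)))

sum-replicate : ∀ n c → sum (replicate n c) ≡ n * c
sum-replicate zero c = refl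
sum-replicate (suc n) c = cong (c +_) (sum-replicate n c)

greedyCoins-zero : ∀ cs → greedyCoins cs 0 ≡ []
greedyCoins-zero [] = refl
greedyCoins-zero (zero ∷ cs) = greedyCoins-zero cs
greedyCoins-zero (suc c ∷ cs) = greedyCoins-zero cs

sum-greedyCoins : ∀ cs v → 1 ∈ cs → sum (greedyCoins cs v) ≡ v
sum-greedyCoins (zero ∷ cs) v (there 1∈cs) = sum-greedyCoins cs v 1∈cs
sum-greedyCoins (suc c ∷ cs) v 1∈ = begin
    sum (replicate q (suc c) ++ greedyCoins cs (v % suc c))
  ≡⟨ sum-++ (replicate q (suc c)) _ ⟩
    sum (replicate q (suc c)) + sum (greedyCoins cs (v % suc c))
  ≡⟨ cong₂ _+_ (sum-replicate q (suc c)) (rest 1∈) ⟩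
    q * suc c + v % suc c
  ≡⟨ +-comm (q * suc c) _ ⟩
    v % suc c + q * suc c
  ≡⟨ m≡m%n+[m/n]*n v (suc c) ⟨
    v ∎
  where
  open ≡-Reasoning
  q = v / suc c
  rest : 1 ∈ (suc c ∷ cs) → sum (greedyCoins cs (v % suc c)) ≡ v % suc c
  rest (here refl) rewrite n%1≡0 v | greedyCoins-zero cs = refl
  rest (there 1∈cs) = sum-greedyCoins cs (v % suc c) 1∈cs

grd-pos : ∀ cs {v} → 1 ∈ cs → 0 < v → 0 < grd cs v
grd-pos cs {v} 1∈cs 0<v = subst (0 <_) (length-greedyCoins (reverse cs) v)
  (nonempty (greedyCoins (reverse cs) v) (sum-greedyCoins (reverse cs) v (reverse⁺ 1∈cs)))
  where
  nonempty : ∀ xs → sum xs ≡ v → 0 < length xs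
  nonempty [] sum≡v = subst (0 <_) (sym sum≡v) 0<v
  nonempty (_ ∷ _) _ = s≤s z≤n

orderly-if-coin-step : ∀ cs → 1 ∈ cs →
  (∀ {c} → c ∈ cs → ∀ w → grd cs (c + w) ≤ suc (grd cs w)) → Orderly cs
orderly-if-coin-step cs 1∈cs step v _ = (greedy , greedy-rep , length-greedyCoins (reverse cs) v) , optimal
  where
  greedy = greedyCoins (reverse cs) v
  greedy-rep : Rep cs v greedy
  greedy-rep = All.map reverse⁻ (greedyCoins-⊆ (reverse cs) v) , sum-greedyCoins (reverse cs) v (reverse⁺ 1∈cs)
  grd-≤-length : ∀ {xs} → All (_∈ cs) xs → grd cs (sum xs) ≤ length xs
  grd-≤-length All.[] = ≤-reflexive (grdDesc-zero (reverse cs))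
  grd-≤-length (x∈cs All.∷ xs⊆cs) = ≤-trans (step x∈cs _) (s≤s (grd-≤-length xs⊆cs))
  optimal : ∀ xs → Rep cs v xs → grd cs v ≤ length xs
  optimal xs (xs⊆cs , refl) = grd-≤-length xs⊆cs

¬orderly-if-pair-beats-greedy : ∀ cs {x y} → x ∈ cs → y ∈ cs → 2 < grd cs (x + y) → ¬ Orderly cs
¬orderly-if-pair-beats-greedy cs {x} {y} x∈cs y∈cs 2<grd orderly =
  <⇒≱ 2<grd (proj₂ (orderly (x + y) 0<x+y) (x ∷ y ∷ []) pair-rep)
  where
  pair-rep : Rep cs (x + y) (x ∷ y ∷ [])
  pair-rep = (x∈cs All.∷ y∈cs All.∷ All.[]) , cong (x +_) (+-identityʳ y)
  0<x+y : 0 < x + y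
  0<x+y = n≢0⇒n>0 λ x+y≡0 →
    <⇒≱ 2<grd (≤-trans (≤-reflexive (trans (cong (grd cs) x+y≡0) (grdDesc-zero (reverse cs)))) z≤n)

-- Prefixes of an increasing sequence of coins

module IncreasingPrefixes (f : ℕ → ℕ) (f0≡1 : f 0 ≡ 1) (f-inc : ∀ k → f k < f (suc k)) where

  g : ℕ → ℕ → ℕ
  g n = grd (applyUpTo f n)

  f-mono : ∀ {m n} → m ≤ n → f m ≤ f n
  f-mono m≤n = go (≤⇒≤′ m≤n)
    where
    go : ∀ {m n} → m ≤′ n → f m ≤ f n
    go ≤′-refl = ≤-refl
    go (≤′-step m≤′n) = ≤-trans (go m≤′n) (<⇒≤ (f-inc _))

  f-pos : ∀ k → 0 < f k
  f-pos k = ≤-trans (≤-reflexive (sym f0≡1)) (f-mono z≤n)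

  reverse-applyUpTo-suc : ∀ n → reverse (applyUpTo f (suc n)) ≡ f n ∷ reverse (applyUpTo f n)
  reverse-applyUpTo-suc n = trans (cong reverse (sym (applyUpTo-∷ʳ f n))) (reverse-++ (applyUpTo f n) [ f n ])

  g-suc : ∀ n v → g (suc n) v ≡ grdDesc (f n ∷ reverse (applyUpTo f n)) v
  g-suc n v = cong (λ cs → grdDesc cs v) (reverse-applyUpTo-suc n)

  g-skip : ∀ n {v} → v < f n → g (suc n) v ≡ g n v
  g-skip n v<fn = trans (g-suc n _) (grdDesc-skip _ v<fn)

  g-top : ∀ n w → g (suc n) (f n + w) ≡ suc (g (suc n) w)
  g-top n w = trans (g-suc n _) (trans (grdDesc-top _ w (f-pos n)) (cong suc (sym (g-suc n w))))

  g-stable : ∀ {k n v} → k ≤ n → v < f k → g n v ≡ g k v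
  g-stable {k} {v = v} k≤n v<fk = go (≤⇒≤′ k≤n)
    where
    go : ∀ {n} → k ≤′ n → g n v ≡ g k v
    go ≤′-refl = refl
    go (≤′-step k≤′n) = trans (g-skip _ (<-≤-trans v<fk (f-mono (≤′⇒≤ k≤′n)))) (go k≤′n)

  g-coin : ∀ {k n} → k < n → g n (f k) ≡ 1
  g-coin {k} {n} k<n = begin
      g n (f k)
    ≡⟨ g-stable k<n (f-inc k) ⟩
      g (suc k) (f k)
    ≡⟨ cong (g (suc k)) (+-identityʳ (f k)) ⟨
      g (suc k) (f k + 0)
    ≡⟨ g-top k 0 ⟩
      suc (g (suc k) 0)
    ≡⟨ cong suc (grdDesc-zero (reverse (applyUpTo f (suc k)))) ⟩
      1 ∎
    where open ≡-Reasoning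

  coin-step-from-below : ∀ n c → (∀ s → s < f n → g (suc n) (c + s) ≤ suc (g (suc n) s)) →
    ∀ w → g (suc n) (c + w) ≤ suc (g (suc n) w)
  coin-step-from-below n c below = <-rec _ step
    where
    P = f n
    step : ∀ w → (∀ {y} → y < w → g (suc n) (c + y) ≤ suc (g (suc n) y)) →
      g (suc n) (c + w) ≤ suc (g (suc n) w)
    step w rec with w <? P
    ... | yes w<P = below w w<P
    ... | no w≮P = subst (λ x → g (suc n) (c + x) ≤ suc (g (suc n) x)) P+w′≡w (begin
          g (suc n) (c + (P + w′))
        ≡⟨ cong (g (suc n)) (x∙yz≈y∙xz c P w′) ⟩
          g (suc n) (P + (c + w′))
        ≡⟨ g-top n (c + w′) ⟩
          suc (g (suc n) (c + w′))
        ≤⟨ s≤s (rec w′<w) ⟩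
          suc (suc (g (suc n) w′))
        ≡⟨ cong suc (g-top n w′) ⟨
          suc (g (suc n) (P + w′)) ∎)
      where
      open ≤-Reasoning
      w′ = w ∸ P
      P+w′≡w : P + w′ ≡ w
      P+w′≡w = m+[n∸m]≡n (≮⇒≥ w≮P)
      w′<w : w′ < w
      w′<w = subst (w′ <_) P+w′≡w (+-monoˡ-≤ w′ (f-pos n))

  prefix-orderly : ∀ n → (∀ k → k ≤ n → ∀ s → s < f n → g (suc n) (f k + s) ≤ suc (g (suc n) s)) →
    Orderly (applyUpTo f (suc n))
  prefix-orderly n below = orderly-if-coin-step _ (here (sym f0≡1)) coin-step
    where
    coin-step : ∀ {c} → c ∈ applyUpTo f (suc n) → ∀ w → g (suc n) (c + w) ≤ suc (g (suc n) w)
    coin-step c∈ with ∈-applyUpTo⁻ f c∈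
    ... | k , k<sn , refl = coin-step-from-below n (f k) (below k (≤-pred k<sn))

-- The sequence d

double : ℕ → ℕ
double zero = 0
double (suc n) = suc (suc (double n))

double≡n+n : ∀ n → double n ≡ n + n
double≡n+n zero = refl
double≡n+n (suc n) = cong suc (trans (cong suc (double≡n+n n)) (sym (+-suc n n)))

double-mono-≤ : ∀ {m n} → m ≤ n → double m ≤ double n
double-mono-≤ z≤n = z≤n
double-mono-≤ (s≤s m≤n) = s≤s (s≤s (double-mono-≤ m≤n))

double-cancel-≤ : ∀ {m n} → double m ≤ double n → m ≤ n
double-cancel-≤ {zero} _ = z≤n
double-cancel-≤ {suc m} {suc n} (s≤s (s≤s 2m≤2n)) = s≤s (double-cancel-≤ 2m≤2n)

double-cancel-< : ∀ {m n} → suc (double m) ≤ double n → m < n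
double-cancel-< {zero} {suc n} _ = s≤s z≤n
double-cancel-< {suc m} {suc n} (s≤s (s≤s 2m<2n)) = s≤s (double-cancel-< 2m<2n)

2n+2≡2+double-n : ∀ n → 2 * n + 2 ≡ 2 + double n
2n+2≡2+double-n n = begin
    2 * n + 2       ≡⟨ solve (n ∷ []) ⟩
    2 + (n + n)     ≡⟨ cong (2 +_) (double≡n+n n) ⟨
    2 + double n    ∎
  where open ≡-Reasoning

3n+1≡1+double-n+n : ∀ n → 3 * n + 1 ≡ suc (double n + n)
3n+1≡1+double-n+n n = begin
    3 * n + 1             ≡⟨ solve (n ∷ []) ⟩
    suc (n + n + n)       ≡⟨ cong (λ x → suc (x + n)) (double≡n+n n) ⟨
    suc (double n + n)    ∎
  where open ≡-Reasoning

3n+2≡2+double-n+n : ∀ n → 3 * n + 2 ≡ 2 + (double n + n)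
3n+2≡2+double-n+n n = trans (+-suc (3 * n) 1) (cong suc (3n+1≡1+double-n+n n))

isOdd-double : ∀ j → isOdd (double j) ≡ false
isOdd-double zero = refl
isOdd-double (suc j) rewrite isOdd-double j = refl

data ParityView : ℕ → Set where
  even : ∀ j → ParityView (double j)
  odd : ∀ j → ParityView (suc (double j))

parityView : ∀ n → ParityView n
parityView zero = even 0
parityView (suc n) with parityView n
... | even j = odd j
... | odd j = even (suc j)

≤ᵇ≡true : ∀ {m n} → m ≤ n → (m ≤ᵇ n) ≡ true
≤ᵇ≡true {m} {n} m≤n with m ≤ᵇ n | ≤⇒≤ᵇ m≤n
... | true | _ = refl

≤ᵇ≡false : ∀ {m n} → n < m → (m ≤ᵇ n) ≡ false
≤ᵇ≡false {m} {n} n<m with m ≤ᵇ n | ≤ᵇ⇒≤ m n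
... | false | _ = refl
... | true | m≤n = ⊥-elim (<⇒≱ n<m (m≤n tt))

module Sequence (r a : ℕ) where

  b : ℕ
  b = suc a

  D : ℕ → ℕ
  D = d r a

  increment : ℕ → ℕ
  increment k = if k ≤ᵇ 2 * r + 2 then (if isOdd k then a else 1) else a + 1

  increment-odd : ∀ {j} → j < r → increment (3 + double j) ≡ a
  increment-odd {j} j<r
    rewrite ≤ᵇ≡true (subst (3 + double j ≤_) (sym (2n+2≡2+double-n r))
                           (s≤s (s≤s (<⇒≤ (double-mono-≤ j<r)))))
          | isOdd-double j = refl

  increment-even : ∀ {j} → j < r → increment (4 + double j) ≡ 1
  increment-even {j} j<r
    rewrite ≤ᵇ≡true (subst (4 + double j ≤_) (sym (2n+2≡2+double-n r)) (s≤s (s≤s (double-mono-≤ j<r))))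
          | isOdd-double j = refl

  increment-tail : ∀ {k} → 2 + double r < k → increment k ≡ a + 1
  increment-tail {k} 2+2r<k rewrite ≤ᵇ≡false {k} (subst (_< k) (sym (2n+2≡2+double-n r)) 2+2r<k) = refl

  increment-pos : 1 ≤ a → ∀ k → 1 ≤ increment k
  increment-pos 1≤a k with k ≤ᵇ 2 * r + 2 | isOdd k
  ... | true | true = 1≤a
  ... | true | false = ≤-refl
  ... | false | _ = m≤n+m 1 a

  D-increasing : 1 ≤ a → ∀ k → D (suc k) < D (suc (suc k))
  D-increasing 1≤a zero = s≤s (s≤s z≤n)
  D-increasing 1≤a (suc k) = m<m+n (D (2 + k)) (increment-pos 1≤a (3 + k))

  D-even : ∀ j → j ≤ r → D (2 + double j) ≡ 2 + j * b
  D-odd : ∀ j → j < r → D (3 + double j) ≡ 2 + j * b + a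
  D-even zero _ = refl
  D-even (suc j) j<r = begin
      D (3 + double j) + increment (4 + double j)
    ≡⟨ cong₂ _+_ (D-odd j j<r) (increment-even j<r) ⟩
      2 + j * suc a + a + 1
    ≡⟨ solve (j ∷ a ∷ []) ⟩
      2 + suc j * suc a ∎
    where open ≡-Reasoning
  D-odd j j<r = cong₂ _+_ (D-even j (<⇒≤ j<r)) (increment-odd j<r)

  D-tail : ∀ m → D (2 + (double r + m)) ≡ 2 + (r + m) * b
  D-tail zero = begin
      D (2 + (double r + 0))
    ≡⟨ cong (λ x → D (2 + x)) (+-identityʳ (double r)) ⟩
      D (2 + double r)
    ≡⟨ D-even r ≤-refl ⟩
      2 + r * b
    ≡⟨ cong (λ x → 2 + x * b) (+-identityʳ r) ⟨
      2 + (r + 0) * b ∎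
    where open ≡-Reasoning
  D-tail (suc m) = begin
      D (2 + (double r + suc m))
    ≡⟨ cong (λ x → D (2 + x)) (+-suc (double r) m) ⟩
      D (2 + (double r + m)) + increment (3 + (double r + m))
    ≡⟨ cong₂ _+_ (D-tail m) (increment-tail (s≤s (s≤s (s≤s (m≤m+n (double r) m))))) ⟩
      2 + (r + m) * suc a + (a + 1)
    ≡⟨ solve (r ∷ m ∷ a ∷ []) ⟩
      2 + (r + suc m) * suc a ∎
    where open ≡-Reasoning

  data Index : ℕ → Set where
    first : Index 1
    even : ∀ j → j ≤ r → Index (2 + double j)
    odd : ∀ j → j < r → Index (3 + double j)
    tail : ∀ m → Index (2 + (double r + suc m))

  index : ∀ k → Index (suc k)
  index k with suc k ≤? 2 + double r
  index k | no k≰2+2r with m≤n⇒∃[o]m+o≡n (≰⇒> k≰2+2r)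
  ... | o , refl = subst Index (cong (2 +_) (+-suc (double r) o)) (tail o)
  index k | yes k≤2+2r with parityView k
  ... | even zero = first
  ... | even (suc j) = odd j (double-cancel-< (≤-pred (≤-pred k≤2+2r)))
  ... | odd j = even j (double-cancel-≤ (≤-pred (≤-pred k≤2+2r)))

-- The pattern of d

⌈1+n/2⌉≤1+⌈n/2⌉ : ∀ n → ⌈ suc n /2⌉ ≤ suc ⌈ n /2⌉
⌈1+n/2⌉≤1+⌈n/2⌉ n = s≤s (⌊n/2⌋≤⌈n/2⌉ n)

module Pattern (r a : ℕ) (1≤r : 1 ≤ r) (2≤a : 2 ≤ a) where

  open Sequence r a
  open IncreasingPrefixes (λ k → D (suc k)) refl (D-increasing (≤-trans (s≤s z≤n) 2≤a))

  D3≡2+a : D 3 ≡ 2 + a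
  D3≡2+a = D-odd 0 1≤r

  b<D3 : b < D 3
  b<D3 = subst (b <_) (sym D3≡2+a) ≤-refl

  coin∈prefix : ∀ {k n} → k < n → D (suc k) ∈ prefix r a n
  coin∈prefix = ∈-applyUpTo⁺ (λ k → D (suc k))

  g-two : ∀ v → g 2 v ≡ ⌈ v /2⌉
  g-two zero = refl
  g-two (suc zero) = refl
  g-two (suc (suc v)) = trans (g-top 1 v) (cong suc (g-two v))

  g-three : ∀ {s} → s < D 3 → g 3 s ≡ ⌈ s /2⌉
  g-three s<D3 = trans (g-skip 2 s<D3) (g-two _)

  g-above : ∀ n t → 2 ≤ n → t < D 3 → g n (D n + t) ≡ suc ⌈ t /2⌉
  g-above (suc n) t (s≤s 1≤n) t<D3 = trans (g-top n t) (cong suc (trans (g-stable (s≤s 1≤n) t<D3) (g-two t)))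

  g-between : ∀ {k n t} → 2 ≤ k → k ≤ n → t < D 3 → D k + t < D (suc k) → g n (D k + t) ≡ suc ⌈ t /2⌉
  g-between 2≤k k≤n t<D3 below = trans (g-stable k≤n below) (g-above _ _ 2≤k t<D3)

  orderly-1 : Orderly (prefix r a 1)
  orderly-1 = prefix-orderly 0 step
    where
    step : ∀ k → k ≤ 0 → ∀ s → s < D 1 → g 1 (D (suc k) + s) ≤ suc (g 1 s)
    step zero _ s _ = ≤-reflexive (g-top 0 s)
    step (suc _) ()

  orderly-2 : Orderly (prefix r a 2)
  orderly-2 = prefix-orderly 1 step
    where
    step : ∀ k → k ≤ 1 → ∀ s → s < D 2 → g 2 (D (suc k) + s) ≤ suc (g 2 s)
    step zero _ s _ = subst₂ (λ x y → x ≤ suc y) (sym (g-two (suc s))) (sym (g-two s)) (⌈1+n/2⌉≤1+⌈n/2⌉ s)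
    step (suc zero) _ s _ = ≤-reflexive (g-top 1 s)
    step (suc (suc _)) (s≤s ())

  small-coin-step : ∀ c → c ≤ 2 → ∀ s → s < D 3 → g 3 (c + s) ≤ suc (g 3 s)
  small-coin-step c c≤2 s s<D3 with c + s <? D 3
  ... | yes c+s<D3 = begin
      g 3 (c + s)    ≡⟨ g-three c+s<D3 ⟩
      ⌈ c + s /2⌉    ≤⟨ ⌈n/2⌉-mono (+-monoˡ-≤ s c≤2) ⟩
      ⌈ 2 + s /2⌉    ≡⟨ cong suc (g-three s<D3) ⟨
      suc (g 3 s)    ∎
    where open ≤-Reasoning
  ... | no c+s≮D3 = begin
      g 3 (c + s)       ≡⟨ cong (g 3) (m+[n∸m]≡n (≮⇒≥ c+s≮D3)) ⟨
      g 3 (D 3 + s′)    ≡⟨ g-top 2 s′ ⟩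
      suc (g 3 s′)      ≡⟨ cong suc (g-three (≤-<-trans s′≤s s<D3)) ⟩
      suc ⌈ s′ /2⌉      ≤⟨ s≤s (⌈n/2⌉-mono s′≤s) ⟩
      suc ⌈ s /2⌉       ≡⟨ cong suc (g-three s<D3) ⟨
      suc (g 3 s)       ∎
    where
    open ≤-Reasoning
    s′ = c + s ∸ D 3
    c≤D3 : c ≤ D 3
    c≤D3 = ≤-trans c≤2 (subst (2 ≤_) (sym D3≡2+a) (m≤m+n 2 a))
    s′≤s : s′ ≤ s
    s′≤s = ≤-trans (∸-monoʳ-≤ (c + s) c≤D3) (≤-reflexive (m+n∸m≡n c s))

  orderly-3 : Orderly (prefix r a 3)
  orderly-3 = prefix-orderly 2 step
    where
    step : ∀ k → k ≤ 2 → ∀ s → s < D 3 → g 3 (D (suc k) + s) ≤ suc (g 3 s)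
    step zero _ = small-coin-step 1 (s≤s z≤n)
    step (suc zero) _ = small-coin-step 2 ≤-refl
    step (suc (suc zero)) _ s _ = ≤-reflexive (g-top 2 s)
    step (suc (suc (suc _))) (s≤s (s≤s ()))

  ¬orderly-if-pair-exceeds-top : ∀ {i t x y} → 2 ≤ i → t < D 3 → 2 ≤ ⌈ t /2⌉ →
    x ∈ prefix r a i → y ∈ prefix r a i → x + y ≡ D i + t → ¬ Orderly (prefix r a i)
  ¬orderly-if-pair-exceeds-top {i} {t} 2≤i t<D3 2≤⌈t/2⌉ x∈ y∈ x+y≡ =
    ¬orderly-if-pair-beats-greedy _ x∈ y∈
      (subst (2 <_) (sym (trans (cong (g i) x+y≡) (g-above i t 2≤i t<D3))) (s≤s 2≤⌈t/2⌉))

  ¬orderly-even : ∀ j → suc j ≤ r → ¬ Orderly (prefix r a (2 + double (suc j)))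
  ¬orderly-even j j<r = ¬orderly-if-pair-exceeds-top (s≤s (s≤s z≤n)) b<D3 (⌈n/2⌉-mono (s≤s 2≤a))
    (coin∈prefix {2} (s≤s (s≤s (s≤s z≤n))))
    (coin∈prefix {2 + double j} (s≤s (s≤s (s≤s (n≤1+n _)))))
    (begin
      D 3 + D (3 + double j)              ≡⟨ cong₂ _+_ D3≡2+a (D-odd j j<r) ⟩
      (2 + a) + (2 + j * suc a + a)       ≡⟨ solve (j ∷ a ∷ []) ⟩
      (2 + suc j * suc a) + suc a         ≡⟨ cong (_+ b) (D-even (suc j) j<r) ⟨
      D (2 + double (suc j)) + b          ∎)
    where open ≡-Reasoning

  ¬orderly-odd : ∀ j → suc j < r → ¬ Orderly (prefix r a (3 + double (suc j)))
  ¬orderly-odd j j<r = ¬orderly-if-pair-exceeds-top (s≤s (s≤s z≤n)) 3<D3 ≤-refl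
    (coin∈prefix {3} (s≤s (s≤s (s≤s (s≤s z≤n)))))
    (coin∈prefix {3 + double j} (s≤s (s≤s (s≤s (s≤s (n≤1+n _))))))
    (begin
      D 4 + D (2 + double (suc j))              ≡⟨ cong₂ _+_ (D-even 1 1≤r) (D-even (suc j) (<⇒≤ j<r)) ⟩
      (2 + 1 * suc a) + (2 + suc j * suc a)     ≡⟨ solve (j ∷ a ∷ []) ⟩
      (2 + suc j * suc a + a) + 3               ≡⟨ cong (_+ 3) (D-odd (suc j) j<r) ⟨
      D (3 + double (suc j)) + 3                ∎)
    where
    open ≡-Reasoning
    3<D3 : 3 < D 3
    3<D3 = subst (3 <_) (sym D3≡2+a) (s≤s (s≤s 2≤a))

  odd-index<tail : ∀ {j} m → j < r → 2 + double j < 2 + (double r + m)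
  odd-index<tail m j<r = s≤s (s≤s (≤-trans (<⇒≤ (double-mono-≤ j<r)) (m≤m+n _ m)))

  ¬orderly-tail : ∀ m → suc m < r → ¬ Orderly (prefix r a (2 + (double r + suc m)))
  ¬orderly-tail m m+1<r with m≤n⇒∃[o]m+o≡n m+1<r
  ... | z , 2+m+z≡r = ¬orderly-if-pair-exceeds-top (s≤s (s≤s z≤n)) b<D3 (⌈n/2⌉-mono (s≤s 2≤a))
    (coin∈prefix (odd-index<tail (suc m) m+1<r)) (coin∈prefix (odd-index<tail (suc m) m+1+z<r)) (begin
        D (3 + double (suc m)) + D (3 + double (suc m + z))
      ≡⟨ cong₂ _+_ (D-odd (suc m) m+1<r) (D-odd (suc m + z) m+1+z<r) ⟩
        (2 + suc m * suc a + a) + (2 + (suc m + z) * suc a + a)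
      ≡⟨ solve (m ∷ z ∷ a ∷ []) ⟩
        2 + (2 + m + z + suc m) * suc a + suc a
      ≡⟨ cong (λ x → 2 + (x + suc m) * b + b) 2+m+z≡r ⟩
        2 + (r + suc m) * b + b
      ≡⟨ cong (_+ b) (D-tail (suc m)) ⟨
        D (2 + (double r + suc m)) + b
      ∎)
    where
    open ≡-Reasoning
    m+1+z<r : suc m + z < r
    m+1+z<r = ≤-reflexive 2+m+z≡r

  tail-index-bound : ∀ m → 2 + (double r + suc m) ≤ 3 * r + 1 → suc m < r
  tail-index-bound m i≤3r+1 = +-cancelˡ-≤ (double r) _ _ (begin
      double r + suc (suc m)    ≡⟨ +-suc (double r) (suc m) ⟩
      suc (double r + suc m)    ≤⟨ ≤-pred (subst (2 + (double r + suc m) ≤_) (3n+1≡1+double-n+n r) i≤3r+1) ⟩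
      double r + r              ∎)
    where
    open ≤-Reasoning

  ¬orderly-middle : ∀ i → 4 ≤ i → i ≤ 3 * r + 1 → ¬ Orderly (prefix r a i)
  ¬orderly-middle (suc i) 4≤i i≤3r+1 with index i
  ¬orderly-middle _ (s≤s ()) _ | first
  ¬orderly-middle _ (s≤s (s≤s ())) _ | even zero _
  ¬orderly-middle _ _ _ | even (suc j) j<r = ¬orderly-even j j<r
  ¬orderly-middle _ (s≤s (s≤s (s≤s ()))) _ | odd zero _
  ¬orderly-middle _ _ _ | odd (suc j) j<r = ¬orderly-odd j j<r
  ¬orderly-middle _ _ i≤3r+1 | tail m = ¬orderly-tail m (tail-index-bound m i≤3r+1)

  M : ℕ
  M = 2 + (r + r) * b

  F : ℕ → ℕ
  F = g (2 + (double r + r))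

  F-wrap : ∀ w → F (M + w) ≡ suc (F w)
  F-wrap w = trans (cong (λ x → F (x + w)) (sym (D-tail r))) (g-top (suc (double r + r)) w)

  F-pos : ∀ {s} → 0 < s → 0 < F s
  F-pos = grd-pos (prefix r a (2 + (double r + r))) (here refl)

  F-one : F 1 ≡ 1
  F-one = g-coin {0} {2 + (double r + r)} (s≤s z≤n)

  block<M⇒ : ∀ {j u} → 2 + j * b + u < M → j < r + r
  block<M⇒ {j} {u} lt = *-cancelʳ-< b j (r + r) (+-cancelˡ-< 2 _ _ (≤-<-trans (m≤m+n (2 + j * b) u) lt))

  F-odd-coin : ∀ j → j < r → F (2 + j * b + a) ≡ 1
  F-odd-coin j j<r = trans (cong F (sym (D-odd j j<r))) (g-coin (odd-index<tail r j<r))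

  F-block-low : ∀ j u → j < r → u < a → F (2 + j * b + u) ≡ suc ⌈ u /2⌉
  F-block-low j u j<r u<a = trans (cong (λ x → F (x + u)) (sym Dk≡))
    (g-between (s≤s (s≤s z≤n)) (<⇒≤ (odd-index<tail r j<r)) (<-trans u<a (<-trans (n<1+n a) b<D3))
      (subst₂ _<_ (cong (_+ u) (sym Dk≡)) (sym (D-odd j j<r)) (+-monoʳ-< (2 + j * b) u<a)))
    where
    Dk≡ : D (2 + double j) ≡ 2 + j * b
    Dk≡ = D-even j (<⇒≤ j<r)

  F-block-high : ∀ m u → m < r → u < b → F (2 + (r + m) * b + u) ≡ suc ⌈ u /2⌉
  F-block-high m u m<r u<b = trans (cong (λ x → F (x + u)) (sym (D-tail m)))
    (g-between (s≤s (s≤s z≤n)) (s≤s (s≤s (+-monoʳ-≤ (double r) (<⇒≤ m<r)))) (<-trans u<b b<D3)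
      (subst₂ _<_ (cong (_+ u) (sym (D-tail m))) (sym next) (+-monoʳ-< (2 + (r + m) * b) u<b)))
    where
    open ≡-Reasoning
    next : D (3 + (double r + m)) ≡ 2 + (r + m) * b + b
    next = begin
      D (3 + (double r + m))          ≡⟨ cong (λ x → D (2 + x)) (+-suc (double r) m) ⟨
      D (2 + (double r + suc m))      ≡⟨ D-tail (suc m) ⟩
      2 + (r + suc m) * suc a         ≡⟨ solve (r ∷ m ∷ a ∷ []) ⟩
      2 + (r + m) * suc a + suc a     ∎

  F-block : ∀ j u → u < b → (j < r → u < a) → 2 + j * b + u < M → F (2 + j * b + u) ≡ suc ⌈ u /2⌉
  F-block j u u<b ordinary in-range with j <? r
  ... | yes j<r = F-block-low j u j<r (ordinary j<r)
  ... | no j≮r with m≤n⇒∃[o]m+o≡n (≮⇒≥ j≮r)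
  ...   | m , refl = F-block-high m u (+-cancelˡ-< r m r (block<M⇒ in-range)) u<b

  odd-coin? : ∀ j u → u < b → (j < r × u ≡ a) ⊎ (j < r → u < a)
  odd-coin? j u u<b with j <? r | u ≟ a
  ... | yes j<r | yes u≡a = inj₁ (j<r , u≡a)
  ... | yes _ | no u≢a = inj₂ (λ _ → ≤∧≢⇒< (≤-pred u<b) u≢a)
  ... | no j≮r | _ = inj₂ (λ j<r → ⊥-elim (j≮r j<r))

  F-block-≤ : ∀ j u → u < b → 2 + j * b + u < M → F (2 + j * b + u) ≤ suc ⌈ u /2⌉
  F-block-≤ j u u<b in-range with odd-coin? j u u<b
  ... | inj₁ (j<r , refl) = ≤-trans (≤-reflexive (F-odd-coin j j<r)) (s≤s z≤n)
  ... | inj₂ ordinary = ≤-reflexive (F-block j u u<b ordinary in-range)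

  F-zero : F 0 ≡ 0
  F-zero = grdDesc-zero (reverse (prefix r a (2 + (double r + r))))

  data Block : ℕ → Set where
    origin : Block 0
    one : Block 1
    block : ∀ j u → u < b → Block (2 + j * b + u)

  block-view : ∀ s → Block s
  block-view zero = origin
  block-view (suc zero) = one
  block-view (suc (suc s)) = subst Block (cong (2 +_) digits) (block (s / b) (s % b) (m%n<n s b))
    where
    digits : s / b * b + s % b ≡ s
    digits = trans (+-comm (s / b * b) (s % b)) (sym (m≡m%n+[m/n]*n s b))

  1<b : 1 < b
  1<b = s≤s (≤-trans (s≤s z≤n) 2≤a)

  coin-step-within-block : ∀ δ l j u → δ ≤ 1 → u < b → 1 + δ + l * b + (2 + j * b + u) < M →
    F (1 + δ + l * b + (2 + j * b + u)) ≤ suc (F (2 + j * b + u))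
  coin-step-within-block δ l j u δ≤1 u<b in-range with 1 + δ + u <? b
  ... | yes fits = begin
      F (1 + δ + l * b + (2 + j * b + u))   ≡⟨ cong F sum≡ ⟩
      F (2 + (l + j) * b + (1 + δ + u))     ≤⟨ F-block-≤ (l + j) (1 + δ + u) fits (subst (_< M) sum≡ in-range) ⟩
      suc ⌈ 1 + δ + u /2⌉                   ≤⟨ s≤s (⌈n/2⌉-mono (s≤s (+-monoˡ-≤ u δ≤1))) ⟩
      suc ⌈ 2 + u /2⌉                       ≡⟨ cong suc (F-block j u u<b (λ _ → u<a) s<M) ⟨
      suc (F (2 + j * b + u))               ∎
    where
    open ≤-Reasoning
    sum≡ : 1 + δ + l * suc a + (2 + j * suc a + u) ≡ 2 + (l + j) * suc a + (1 + δ + u)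
    sum≡ = solve (δ ∷ l ∷ j ∷ u ∷ a ∷ [])
    u<a : u < a
    u<a = ≤-<-trans (m≤n+m u δ) (≤-pred fits)
    s<M : 2 + j * b + u < M
    s<M = ≤-<-trans (m≤n+m (2 + j * b + u) (1 + δ + l * b)) in-range
  ... | no overflows with m≤n⇒∃[o]m+o≡n (≮⇒≥ overflows)
  ...   | u′ , b+u′≡ = begin
      F (1 + δ + l * b + (2 + j * b + u))   ≡⟨ cong F sum≡ ⟩
      F (2 + suc (l + j) * b + u′)          ≤⟨ F-block-≤ (suc (l + j)) u′ u′<b (subst (_< M) sum≡ in-range) ⟩
      suc ⌈ u′ /2⌉                          ≤⟨ s≤s (⌈n/2⌉-mono u′≤1) ⟩
      2                                     ≤⟨ s≤s (F-pos (s≤s z≤n)) ⟩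
      suc (F (2 + j * b + u))               ∎
    where
    open ≤-Reasoning
    sum≡ : 1 + δ + l * suc a + (2 + j * suc a + u) ≡ 2 + suc (l + j) * suc a + u′
    sum≡ = begin-equality
      1 + δ + l * suc a + (2 + j * suc a + u)   ≡⟨ solve (δ ∷ l ∷ j ∷ u ∷ a ∷ []) ⟩
      2 + (l + j) * suc a + (1 + δ + u)         ≡⟨ cong (2 + (l + j) * suc a +_) b+u′≡ ⟨
      2 + (l + j) * suc a + (suc a + u′)        ≡⟨ solve (l ∷ j ∷ u′ ∷ a ∷ []) ⟩
      2 + suc (l + j) * suc a + u′              ∎
    u′≤1 : u′ ≤ 1
    u′≤1 = +-cancelˡ-≤ b u′ 1 (begin
      b + u′       ≡⟨ b+u′≡ ⟩
      1 + δ + u    ≤⟨ s≤s (+-mono-≤ δ≤1 (≤-pred u<b)) ⟩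
      2 + a        ≡⟨ +-comm b 1 ⟨
      b + 1        ∎)
    u′<b : u′ < b
    u′<b = ≤-<-trans u′≤1 1<b

  coin-step-within : ∀ δ l s → δ ≤ 1 → 0 < s → 1 + δ + l * b + s < M → F (1 + δ + l * b + s) ≤ suc (F s)
  coin-step-within δ l s δ≤1 0<s in-range with block-view s
  coin-step-within _ _ _ _ () _ | origin
  ... | one = begin
      F (1 + δ + l * b + 1)    ≡⟨ cong F sum≡ ⟩
      F (2 + l * b + δ)        ≤⟨ F-block-≤ l δ (≤-<-trans δ≤1 1<b) (subst (_< M) sum≡ in-range) ⟩
      suc ⌈ δ /2⌉              ≤⟨ s≤s (⌈n/2⌉-mono δ≤1) ⟩
      2                        ≡⟨ cong suc F-one ⟨
      suc (F 1)                ∎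
    where
    open ≤-Reasoning
    sum≡ : 1 + δ + l * suc a + 1 ≡ 2 + l * suc a + δ
    sum≡ = solve (δ ∷ l ∷ a ∷ [])
  ... | block j u u<b = coin-step-within-block δ l j u δ≤1 u<b in-range

  -- When c + s wraps past M greedy leaves s − (M − c), and M − (2 + l b) = K b while
  -- M − (1 + l b) = 1 + K b with K ≥ r; these two shifts never lower F.
  F-shift : ∀ K s → s + K * b < M → F s ≤ F (s + K * b)
  F-shift K s in-range with block-view s
  ... | origin = ≤-trans (≤-reflexive F-zero) z≤n
  ... | one = subst (_≤ F (1 + K * b)) (sym F-one) (F-pos (s≤s z≤n))
  ... | block j u u<b with odd-coin? j u u<b
  ...   | inj₁ (j<r , refl) = subst (_≤ F (2 + j * b + a + K * b)) (sym (F-odd-coin j j<r)) (F-pos (s≤s z≤n))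
  ...   | inj₂ ordinary = ≤-reflexive (begin
      F (2 + j * b + u)              ≡⟨ F-block j u u<b ordinary (≤-<-trans (m≤m+n _ (K * b)) in-range) ⟩
      suc ⌈ u /2⌉                    ≡⟨ F-block (j + K) u u<b ordinary′ (subst (_< M) shift≡ in-range) ⟨
      F (2 + (j + K) * b + u)        ≡⟨ cong F shift≡ ⟨
      F (2 + j * b + u + K * b)      ∎)
    where
    open ≡-Reasoning
    ordinary′ : j + K < r → u < a
    ordinary′ j+K<r = ordinary (≤-<-trans (m≤m+n j K) j+K<r)
    shift≡ : 2 + j * suc a + u + K * suc a ≡ 2 + (j + K) * suc a + u
    shift≡ = solve (j ∷ u ∷ K ∷ a ∷ [])

  F-shift-one : ∀ K s → r ≤ K → s + (1 + K * b) < M → F s ≤ F (s + (1 + K * b))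
  F-shift-one K s r≤K in-range with block-view s
  ... | origin = ≤-trans (≤-reflexive F-zero) z≤n
  ... | one = subst (_≤ F (1 + (1 + K * b))) (sym F-one) (F-pos (s≤s z≤n))
  ... | block j u u<b with suc u <? b
  ...   | yes u+1<b = begin
      F (2 + j * b + u)                  ≤⟨ F-block-≤ j u u<b (≤-<-trans (m≤m+n _ (1 + K * b)) in-range) ⟩
      suc ⌈ u /2⌉                        ≤⟨ s≤s (⌈n/2⌉-mono (n≤1+n u)) ⟩
      suc ⌈ suc u /2⌉                    ≡⟨ F-block (j + K) (suc u) u+1<b high (subst (_< M) shift≡ in-range) ⟨
      F (2 + (j + K) * b + suc u)        ≡⟨ cong F shift≡ ⟨
      F (2 + j * b + u + (1 + K * b))    ∎
    where
    open ≤-Reasoning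
    high : j + K < r → suc u < a
    high j+K<r = ⊥-elim (<⇒≱ j+K<r (≤-trans r≤K (m≤n+m K j)))
    shift≡ : 2 + j * suc a + u + (1 + K * suc a) ≡ 2 + (j + K) * suc a + suc u
    shift≡ = solve (j ∷ u ∷ K ∷ a ∷ [])
  ...   | no u+1≮b with suc-injective (≤-antisym u<b (≮⇒≥ u+1≮b))
  ...     | refl = subst (_≤ F (2 + j * b + a + (1 + K * b))) (sym (F-odd-coin j j<r)) (F-pos (s≤s z≤n))
    where
    shift≡ : 2 + j * suc a + a + (1 + K * suc a) ≡ 2 + suc (j + K) * suc a + 0
    shift≡ = solve (j ∷ K ∷ a ∷ [])
    j<r : j < r
    j<r = <-trans (n<1+n j) (+-cancelʳ-< K (suc j) r
      (≤-trans (block<M⇒ (subst (_< M) shift≡ in-range)) (+-monoʳ-≤ r r≤K)))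

  F-wrap-≤ : ∀ {c s s′} → M + s′ ≡ c + s → F s′ ≤ F s → F (c + s) ≤ suc (F s)
  F-wrap-≤ {c} {s} {s′} M+s′≡c+s F-s′≤F-s = begin
      F (c + s)      ≡⟨ cong F M+s′≡c+s ⟨
      F (M + s′)     ≡⟨ F-wrap s′ ⟩
      suc (F s′)     ≤⟨ s≤s F-s′≤F-s ⟩
      suc (F s)      ∎
    where open ≤-Reasoning

  coin-step-one : ∀ l s → l ≤ r → 0 < s → s < M → F (1 + l * b + s) ≤ suc (F s)
  coin-step-one l s l≤r 0<s s<M with 1 + l * b + s <? M
  ... | yes in-range = coin-step-within 0 l s z≤n 0<s in-range
  ... | no wraps with m≤n⇒∃[o]m+o≡n (≮⇒≥ wraps) | m≤n⇒∃[o]m+o≡n (≤-trans l≤r (m≤m+n r r))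
  ...   | s′ , M+s′≡ | K , l+K≡2r = F-wrap-≤ M+s′≡
          (subst (λ x → F s′ ≤ F x) (sym s≡) (F-shift-one K s′ r≤K (subst (_< M) s≡ s<M)))
    where
    open ≡-Reasoning
    r≤K : r ≤ K
    r≤K = +-cancelˡ-≤ r r K (≤-trans (≤-reflexive (sym l+K≡2r)) (+-monoˡ-≤ K l≤r))
    s≡ : s ≡ s′ + (1 + K * b)
    s≡ = +-cancelˡ-≡ (1 + l * b) s _ (begin
      1 + l * b + s                    ≡⟨ M+s′≡ ⟨
      2 + (r + r) * b + s′             ≡⟨ cong (λ x → 2 + x * b + s′) l+K≡2r ⟨
      2 + (l + K) * suc a + s′         ≡⟨ solve (l ∷ K ∷ s′ ∷ a ∷ []) ⟩
      1 + l * suc a + (s′ + (1 + K * suc a)) ∎)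

  coin-step-two : ∀ l s → l ≤ r + r → 0 < s → s < M → F (2 + l * b + s) ≤ suc (F s)
  coin-step-two l s l≤2r 0<s s<M with 2 + l * b + s <? M
  ... | yes in-range = coin-step-within 1 l s ≤-refl 0<s in-range
  ... | no wraps with m≤n⇒∃[o]m+o≡n (≮⇒≥ wraps) | m≤n⇒∃[o]m+o≡n l≤2r
  ...   | s′ , M+s′≡ | K , l+K≡2r = F-wrap-≤ M+s′≡
          (subst (λ x → F s′ ≤ F x) (sym s≡) (F-shift K s′ (subst (_< M) s≡ s<M)))
    where
    open ≡-Reasoning
    s≡ : s ≡ s′ + K * b
    s≡ = +-cancelˡ-≡ (2 + l * b) s _ (begin
      2 + l * b + s                    ≡⟨ M+s′≡ ⟨
      2 + (r + r) * b + s′             ≡⟨ cong (λ x → 2 + x * b + s′) l+K≡2r ⟨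
      2 + (l + K) * suc a + s′         ≡⟨ solve (l ∷ K ∷ s′ ∷ a ∷ []) ⟩
      2 + l * suc a + (s′ + K * suc a) ∎)

  coin-shape : ∀ k → k ≤ suc (double r + r) →
    (∃ λ l → l ≤ r × D (suc k) ≡ 1 + l * b) ⊎ (∃ λ l → l ≤ r + r × D (suc k) ≡ 2 + l * b)
  coin-shape k k≤ with index k
  ... | first = inj₁ (0 , z≤n , refl)
  ... | even j j≤r = inj₂ (j , ≤-trans j≤r (m≤m+n r r) , D-even j j≤r)
  ... | odd j j<r = inj₁ (suc j , j<r , (begin
      D (3 + double j)        ≡⟨ D-odd j j<r ⟩
      2 + j * suc a + a       ≡⟨ solve (j ∷ a ∷ []) ⟩
      1 + suc j * suc a       ∎))
    where open ≡-Reasoning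
  ... | tail m = inj₂ (r + suc m , +-monoʳ-≤ r (+-cancelˡ-≤ (double r) _ _ (≤-pred k≤)) , D-tail (suc m))

  full-coin-step : ∀ k → k ≤ suc (double r + r) → ∀ s → s < D (2 + (double r + r)) →
    F (D (suc k) + s) ≤ suc (F s)
  full-coin-step k k≤ zero _ =
    ≤-reflexive (trans (cong F (+-identityʳ (D (suc k)))) (trans (g-coin (s≤s k≤)) (cong suc (sym F-zero))))
  full-coin-step k k≤ (suc s) s<top with coin-shape k k≤ | subst (suc s <_) (D-tail r) s<top
  ... | inj₁ (l , l≤r , coin≡) | s<M rewrite coin≡ = coin-step-one l (suc s) l≤r (s≤s z≤n) s<M
  ... | inj₂ (l , l≤2r , coin≡) | s<M rewrite coin≡ = coin-step-two l (suc s) l≤2r (s≤s z≤n) s<M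

  orderly-full : Orderly (prefix r a (2 + (double r + r)))
  orderly-full = prefix-orderly (suc (double r + r)) full-coin-step

theorem4p3 : (r a : ℕ) → 1 ≤ r → 2 ≤ a →
    Orderly (prefix r a 1) × Orderly (prefix r a 2) × Orderly (prefix r a 3)
    × (∀ i → 4 ≤ i → i ≤ 3 * r + 1 → ¬ Orderly (prefix r a i))
    × Orderly (prefix r a (3 * r + 2))
theorem4p3 r a 1≤r 2≤a =
  orderly-1 , orderly-2 , orderly-3 , ¬orderly-middle ,
  subst (λ n → Orderly (prefix r a n)) (sym (3n+2≡2+double-n+n r)) orderly-full
  where open Pattern r a 1≤r 2≤a
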